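{- There are infinitely many pairwise non-isomorphic finite connected cubic (3-regular) bipartite graphs that have no adjacency eigenvalues in the open interval $(-1,1)$.
   Context: Eigenvalues of a finite graph are the eigenvalues of its adjacency matrix. -}

module Defs where

open import Level using (0ℓ)
open import Data.Nat using (ℕ; zero; suc)
open import Data.Bool using (Bool; true; false; if_then_else_)
open import Data.Fin using (Fin)
import Data.Fin as F
open import Data.List using (length; filterᵇ; allFin)
open import Data.Product using (Σ; ∃; _×_; _,_; proj₁; proj₂)
open import Data.Sum using (_⊎_)
open import Relation.Nullary using (¬_)
open import Relation.Binary.PropositionalEquality using (_≡_; _≢_)
open import Relation.Binary.Structures using (IsStrictTotalOrder)
open import Relation.Binary.Construct.Closure.ReflexiveTransitive using (Star)
open import Algebra.Structures using (IsCommutativeRing)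
open import Function.Bundles using (Inverse)
import Relation.Binary.PropositionalEquality as Eq

-- The real numbers, axiomatised as a complete ordered field
-- (any model is isomorphic to ℝ).  Equality is propositional equality.

record Reals : Set₁ where
  field
    ℝ    : Set
    _+_  : ℝ → ℝ → ℝ
    _*_  : ℝ → ℝ → ℝ
    -_   : ℝ → ℝ
    0ℝ   : ℝ
    1ℝ   : ℝ
    _<_  : ℝ → ℝ → Set
    isCommutativeRing : IsCommutativeRing _≡_ _+_ _*_ -_ 0ℝ 1ℝ
    0≢1     : 0ℝ ≢ 1ℝ
    inverse : ∀ x → x ≢ 0ℝ → Σ ℝ (λ y → x * y ≡ 1ℝ)
    isStrictTotalOrder : IsStrictTotalOrder _≡_ _<_
    +-mono-< : ∀ {x y} z → x < y → (x + z) < (y + z)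
    *-pos    : ∀ {x y} → 0ℝ < x → 0ℝ < y → 0ℝ < (x * y)

  _≤_ : ℝ → ℝ → Set
  x ≤ y = (x < y) ⊎ (x ≡ y)

  IsUpperBound : (ℝ → Set) → ℝ → Set
  IsUpperBound S b = ∀ x → S x → x ≤ b

  field
    complete : (S : ℝ → Set) → Σ ℝ S → Σ ℝ (IsUpperBound S) →
               Σ ℝ (λ s → IsUpperBound S s × (∀ b → IsUpperBound S b → s ≤ b))

record Graph (n : ℕ) : Set where
  field
    adj     : Fin n → Fin n → Bool
    sym     : ∀ u v → adj u v ≡ adj v u
    irrefl  : ∀ v → adj v v ≡ false
open Graph public

Adjacent : ∀ {n} → Graph n → Fin n → Fin n → Set
Adjacent G u v = adj G u v ≡ true

degree : ∀ {n} → Graph n → Fin n → ℕ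
degree {n} G v = length (filterᵇ (adj G v) (allFin n))

Cubic : ∀ {n} → Graph n → Set
Cubic {n} G = ∀ (v : Fin n) → degree G v ≡ 3

Connected : ∀ {n} → Graph n → Set
Connected {n} G = ∀ (u v : Fin n) → Star (Adjacent G) u v

Bipartite : ∀ {n} → Graph n → Set
Bipartite {n} G = Σ (Fin n → Bool) λ c → ∀ u v → Adjacent G u v → c u ≢ c v

Isomorphic : ∀ {n m} → Graph n → Graph m → Set
Isomorphic {n} {m} G H =
  Σ (Inverse (Eq.setoid (Fin n))
             (Eq.setoid (Fin m)))
    λ f → ∀ u v → adj G u v ≡ adj H (Inverse.to f u) (Inverse.to f v)

module _ (R : Reals) where
  open Reals R

  sumℝ : ∀ {n} → (Fin n → ℝ) → ℝ
  sumℝ {zero}  f = 0ℝ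
  sumℝ {suc n} f = f F.zero + sumℝ (λ i → f (F.suc i))

  adjMatrix : ∀ {n} → Graph n → Fin n → Fin n → ℝ
  adjMatrix G u v = if adj G u v then 1ℝ else 0ℝ

  IsEigenvalue : ∀ {n} → Graph n → ℝ → Set
  IsEigenvalue {n} G λ' =
    Σ (Fin n → ℝ) λ x →
      (Σ (Fin n) λ i → x i ≢ 0ℝ) ×
      (∀ i → sumℝ (λ j → adjMatrix G i j * x j) ≡ λ' * x i)

  NoEigenvalueIn-1,1 : ∀ {n} → Graph n → Set
  NoEigenvalueIn-1,1 G = ∀ λ' → (- 1ℝ) < λ' → λ' < 1ℝ → ¬ IsEigenvalue G λ'

-- The graphs are "necklaces": beads i ∈ ℤ/m, each carrying white vertices
-- W⁰ᵢ, W¹ᵢ and black vertices B⁰ᵢ, B¹ᵢ, with Wᵢ–Bᵢ complete bipartite and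
-- Wˢᵢ joined to Bˢᵢ₋₁.  For m ≥ 2 they are connected, cubic and bipartite, and
-- they are pairwise non-isomorphic, having 4m vertices.  Let A x = l x with
-- |l| < 1 and e = 1 − l².  The two vertices of a colour on a bead have the same
-- neighbours except for one partner each; as l² ≠ 1, x takes the same value yᵢ
-- on both.  Two steps of the eigenvalue equation then give
-- (4 + e) yᵢ + 2 (yᵢ₋₁ + yᵢ₊₁) = 0 for each colour, which is impossible at a
-- bead maximising yᵢ² unless y = 0.
module Submission where

open import Level using (0ℓ)
open import Data.Nat using (ℕ; zero; suc)
import Data.Nat as ℕ
import Data.Nat.Properties as ℕ
open import Data.Bool using (Bool; true; false; _∧_; _∨_; if_then_else_)
open import Data.Bool.Properties using (∨-zeroʳ; ∧-distribʳ-∨; ¬-not; ⇔→≡)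
open import Data.Fin using (Fin; zero; suc; fromℕ; inject₁; combine; remQuot)
open import Data.Fin.Patterns using (0F; 1F; 2F)
open import Data.Fin.Properties
  using (_≟_; suc-injective; remQuot-combine; combine-remQuot; cantor-schröder-bernstein)
open import Data.Fin.Induction using (<-weakInduction)
open import Data.List using (length; filterᵇ; tabulate)
open import Data.Product using (Σ; ∃-syntax; _×_; _,_; proj₁; proj₂; map₂)
open import Data.Sum using (inj₁; inj₂)
open import Data.Empty using (⊥-elim)
open import Function using (_∘_; Injective)
open import Function.Bundles using (_↔_; Injection; mk⇔)
open import Function.Properties.Inverse using (↔-sym; ↔⇒↣)
open import Relation.Nullary using (¬_; yes; no; does)
open import Relation.Nullary.Decidable using (dec-true; decidable-stable)
open import Relation.Binary.Definitions using (tri<; tri≈; tri>)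
open import Relation.Binary.Structures using (IsStrictTotalOrder)
open import Relation.Binary.Construct.Closure.ReflexiveTransitive
  using (Star; _◅_; _◅◅_; reverse) renaming (ε to [])
open import Algebra.Bundles using (RawRing; CommutativeRing; CommutativeMonoid)
open import Relation.Binary.PropositionalEquality
  using (_≡_; _≢_; refl; sym; trans; cong; cong₂; subst; subst₂; module ≡-Reasoning)
open import Defs hiding (sym)

-- The ring solver over an arbitrary commutative ring, with coefficients the
-- formal differences p − n of naturals, so that integer constants normalise.
module DifferenceCoefficientSolver {c ℓ} (R : CommutativeRing c ℓ) where
  open CommutativeRing R hiding (refl; sym; trans)
  private module ≈ = CommutativeRing R
  open import Algebra.Properties.Semiring.Mult semiring using (×-homo-+; ×1-homo-*)
    renaming (_×_ to _·_)
  open import Algebra.Properties.Ring ring using (-‿distribˡ-*; -‿distribʳ-*)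
  open import Algebra.Properties.AbelianGroup +-abelianGroup using (⁻¹-∙-comm)
  open import Algebra.Properties.Group +-group using (⁻¹-involutive; ε⁻¹≈ε)
  open import Algebra.Properties.CommutativeSemigroup +-commutativeSemigroup
    using (interchange)
  import Algebra.Solver.Ring.AlmostCommutativeRing as ACR
  open import Relation.Binary.Reasoning.Setoid setoid
  open import Relation.Binary.Definitions using (WeaklyDecidable)
  open import Data.Maybe using (just; nothing)

  differences : RawRing 0ℓ 0ℓ
  differences = record
    { Carrier = ℕ × ℕ
    ; _≈_ = _≡_
    ; _+_ = λ { (p , n) (p′ , n′) → p ℕ.+ p′ , n ℕ.+ n′ }
    ; _*_ = λ { (p , n) (p′ , n′) → p ℕ.* p′ ℕ.+ n ℕ.* n′ , p ℕ.* n′ ℕ.+ n ℕ.* p′ }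
    ; -_ = λ { (p , n) → n , p }
    ; 0# = 0 , 0
    ; 1# = 1 , 0
    }

  fromDifference : ℕ × ℕ → Carrier
  fromDifference (p , n) = p · 1# - n · 1#

  infix 9 #_
  #_ : ℕ → Carrier
  # k = fromDifference (k , 0)

  private
    -‿distrib-+ : ∀ a b → - (a + b) ≈ - a + - b
    -‿distrib-+ a b = ≈.sym (⁻¹-∙-comm a b)

    *-homo : ∀ p n p′ n′ → fromDifference (p ℕ.* p′ ℕ.+ n ℕ.* n′ , p ℕ.* n′ ℕ.+ n ℕ.* p′)
                         ≈ fromDifference (p , n) * fromDifference (p′ , n′)
    *-homo p n p′ n′ = begin
      (p ℕ.* p′ ℕ.+ n ℕ.* n′) · 1# - (p ℕ.* n′ ℕ.+ n ℕ.* p′) · 1#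
        ≈⟨ +-cong (≈.trans (×-homo-+ 1# (p ℕ.* p′) (n ℕ.* n′))
                           (+-cong (×1-homo-* p p′) (×1-homo-* n n′)))
                  (-‿cong (≈.trans (×-homo-+ 1# (p ℕ.* n′) (n ℕ.* p′))
                                   (+-cong (×1-homo-* p n′) (×1-homo-* n p′)))) ⟩
      (P * P′ + N * N′) - (P * N′ + N * P′)          ≈⟨ +-congˡ (-‿distrib-+ _ _) ⟩
      (P * P′ + N * N′) + (- (P * N′) + - (N * P′))  ≈⟨ interchange _ _ _ _ ⟩
      (P * P′ + - (P * N′)) + (N * N′ + - (N * P′))
        ≈⟨ +-cong (+-congˡ (-‿distribʳ-* P N′))
                  (+-cong (≈.trans (≈.sym (⁻¹-involutive _))
                                   (≈.trans (-‿cong (-‿distribʳ-* N N′)) (-‿distribˡ-* N (- N′))))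
                          (-‿distribˡ-* N P′)) ⟩
      (P * P′ + P * (- N′)) + ((- N) * (- N′) + (- N) * P′)
        ≈⟨ +-cong (≈.sym (distribˡ P P′ (- N′)))
                  (≈.trans (+-comm _ _) (≈.sym (distribˡ (- N) P′ (- N′)))) ⟩
      P * (P′ - N′) + (- N) * (P′ - N′)              ≈⟨ ≈.sym (distribʳ _ P (- N)) ⟩
      (P - N) * (P′ - N′)                            ∎
      where P = p · 1#; N = n · 1#; P′ = p′ · 1#; N′ = n′ · 1#

    homomorphism : differences ACR.-Raw-AlmostCommutative⟶ ACR.fromCommutativeRing R
    homomorphism = record
      { ⟦_⟧ = fromDifference
      ; +-homo = λ { (p , n) (p′ , n′) → begin
          (p ℕ.+ p′) · 1# - (n ℕ.+ n′) · 1#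
            ≈⟨ +-cong (×-homo-+ 1# p p′) (-‿cong (×-homo-+ 1# n n′)) ⟩
          (p · 1# + p′ · 1#) - (n · 1# + n′ · 1#)         ≈⟨ +-congˡ (-‿distrib-+ _ _) ⟩
          (p · 1# + p′ · 1#) + (- (n · 1#) + - (n′ · 1#)) ≈⟨ interchange _ _ _ _ ⟩
          fromDifference (p , n) + fromDifference (p′ , n′) ∎ }
      ; *-homo = λ { (p , n) (p′ , n′) → *-homo p n p′ n′ }
      ; -‿homo = λ { (p , n) → begin
          n · 1# - p · 1#                ≈⟨ +-comm _ _ ⟩
          - (p · 1#) + n · 1#            ≈⟨ +-congˡ (≈.sym (⁻¹-involutive _)) ⟩
          - (p · 1#) + - (- (n · 1#))    ≈⟨ ≈.sym (-‿distrib-+ _ _) ⟩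
          - fromDifference (p , n)       ∎ }
      ; 0-homo = ≈.trans (+-congˡ ε⁻¹≈ε) (+-identityʳ 0#)
      ; 1-homo = ≈.trans (+-congʳ (+-identityʳ 1#)) (≈.trans (+-congˡ ε⁻¹≈ε) (+-identityʳ 1#))
      }

    difference-≟ : WeaklyDecidable (λ x y → fromDifference x ≈ fromDifference y)
    difference-≟ (p , n) (p′ , n′) with p ℕ.+ n′ ℕ.≟ p′ ℕ.+ n
    ... | no _ = nothing
    ... | yes e = just (begin
        P - N                     ≈⟨ ≈.sym (+-identityʳ _) ⟩
        (P - N) + 0#              ≈⟨ +-congˡ (≈.sym (-‿inverseʳ N′)) ⟩
        (P - N) + (N′ - N′)       ≈⟨ interchange _ _ _ _ ⟩
        (P + N′) + (- N + - N′)
          ≈⟨ +-congʳ (≈.trans (≈.sym (×-homo-+ 1# p n′))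
                              (≈.trans (≈.reflexive (cong (_· 1#) e)) (×-homo-+ 1# p′ n))) ⟩
        (P′ + N) + (- N + - N′)   ≈⟨ interchange _ _ _ _ ⟩
        (P′ + - N) + (N + - N′)   ≈⟨ +-congˡ (+-comm _ _) ⟩
        (P′ + - N) + (- N′ + N)   ≈⟨ ≈.sym (interchange _ _ _ _) ⟩
        (P′ - N′) + (- N + N)     ≈⟨ +-congˡ (-‿inverseˡ N) ⟩
        (P′ - N′) + 0#            ≈⟨ +-identityʳ _ ⟩
        P′ - N′                   ∎)
      where P = p · 1#; N = n · 1#; P′ = p′ · 1#; N′ = n′ · 1#

  open import Algebra.Solver.Ring differences (ACR.fromCommutativeRing R) homomorphism difference-≟
    public

  κ : ∀ {n} → ℕ → Polynomial n
  κ k = con (k , 0)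

module IndicatorSums {a ℓ} (M : CommutativeMonoid a ℓ) where
  open CommutativeMonoid M hiding (refl; sym; trans)
  private module ≈ = CommutativeMonoid M
  open import Algebra.Properties.Monoid.Sum monoid public using (sum)
  open import Algebra.Properties.Monoid.Sum monoid using (sum-cong-≋; sum-replicate-zero)
  open import Algebra.Properties.CommutativeMonoid.Sum M using (∑-distrib-+)

  ∑-indicator : ∀ {n} (p : Fin n) (x : Fin n → Carrier) →
                sum (λ w → if does (w ≟ p) then x w else ε) ≈ x p
  ∑-indicator {suc n} zero x = ≈.trans (∙-congˡ (sum-replicate-zero n)) (identityʳ (x zero))
  ∑-indicator (suc p) x = ≈.trans (identityˡ _) (∑-indicator p (x ∘ suc))

  ∑-∨ : ∀ {n} (a b : Fin n → Bool) (x : Fin n → Carrier) → (∀ w → a w ∧ b w ≡ false) →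
        sum (λ w → if a w ∨ b w then x w else ε)
        ≈ sum (λ w → if a w then x w else ε) ∙ sum (λ w → if b w then x w else ε)
  ∑-∨ a b x disjoint = ≈.trans (sum-cong-≋ (λ w → if-∨ (a w) (b w) (disjoint w)))
                       (∑-distrib-+ (λ w → if a w then x w else ε) (λ w → if b w then x w else ε))
    where
    if-∨ : ∀ a b {z} → a ∧ b ≡ false →
           (if a ∨ b then z else ε) ≈ (if a then z else ε) ∙ (if b then z else ε)
    if-∨ true  false _ = ≈.sym (identityʳ _)
    if-∨ false true  _ = ≈.sym (identityˡ _)
    if-∨ false false _ = ≈.sym (identityˡ ε)

module RealProperties (R : Reals) where
  -- R's own operators have no fixity declarations; the ring's (the same functions) do.
  open Reals R hiding (_+_; _*_; -_)

  ring : CommutativeRing 0ℓ 0ℓ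
  ring = record { isCommutativeRing = isCommutativeRing }

  open CommutativeRing ring public
    using ( _+_; _*_; -_; _-_; +-comm; +-assoc; +-identityˡ; +-identityʳ; *-identityˡ
          ; zeroˡ; zeroʳ; -‿inverseʳ; +-monoid; +-commutativeMonoid)
  open DifferenceCoefficientSolver ring public using (#_; κ; solve; _:=_; _:+_; _:*_; :-_; _:-_)
  open import Algebra.Properties.Group (CommutativeRing.+-group ring) public
    using (inverseʳ-unique) renaming (∙-cancelˡ to +-cancelˡ; ∙-cancelʳ to +-cancelʳ)
  open import Algebra.Properties.Monoid.Sum +-monoid public using (sum; sum-cong-≗)
  open IsStrictTotalOrder isStrictTotalOrder public using () renaming (_≟_ to _≟ℝ_)
  open IsStrictTotalOrder isStrictTotalOrder using (compare)
  open ≡-Reasoning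

  sumℝ≡sum : ∀ {n} (f : Fin n → ℝ) → sumℝ R f ≡ sum f
  sumℝ≡sum {zero} f = refl
  sumℝ≡sum {suc n} f = cong (f zero +_) (sumℝ≡sum (f ∘ suc))

  <-irrefl : ∀ {x} → ¬ x < x
  <-irrefl = IsStrictTotalOrder.irrefl isStrictTotalOrder refl

  <-trans : ∀ {x y z} → x < y → y < z → x < z
  <-trans = IsStrictTotalOrder.trans isStrictTotalOrder

  <-≤-trans : ∀ {x y z} → x < y → y ≤ z → x < z
  <-≤-trans x<y (inj₁ y<z) = <-trans x<y y<z
  <-≤-trans x<y (inj₂ refl) = x<y

  ≤-<-trans : ∀ {x y z} → x ≤ y → y < z → x < z
  ≤-<-trans (inj₁ x<y) y<z = <-trans x<y y<z
  ≤-<-trans (inj₂ refl) y<z = y<z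

  <⇒gap : ∀ {x y} → x < y → ∃[ t ] 0ℝ < t × x + t ≡ y
  <⇒gap {x} {y} x<y =
    y + - x , subst (_< (y + - x)) (-‿inverseʳ x) (+-mono-< (- x) x<y)
            , solve 2 (λ x y → x :+ (y :- x) := y) refl x y

  ≤⇒gap : ∀ {x y} → x ≤ y → ∃[ t ] 0ℝ ≤ t × x + t ≡ y
  ≤⇒gap (inj₁ x<y) with t , 0<t , x+t≡y ← <⇒gap x<y = t , inj₁ 0<t , x+t≡y
  ≤⇒gap {x} (inj₂ refl) = 0ℝ , inj₂ refl , +-identityʳ x

  +-pos : ∀ {a b} → 0ℝ < a → 0ℝ < b → 0ℝ < (a + b)
  +-pos {a} {b} 0<a 0<b =
    <-trans 0<a (subst₂ _<_ (+-identityˡ a) (+-comm b a) (+-mono-< a 0<b))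

  +-nonneg-pos : ∀ {a b} → 0ℝ ≤ a → 0ℝ < b → 0ℝ < (a + b)
  +-nonneg-pos (inj₁ 0<a) 0<b = +-pos 0<a 0<b
  +-nonneg-pos {b = b} (inj₂ refl) 0<b = subst (0ℝ <_) (sym (+-identityˡ b)) 0<b

  +-nonneg : ∀ {a b} → 0ℝ ≤ a → 0ℝ ≤ b → 0ℝ ≤ (a + b)
  +-nonneg 0≤a (inj₁ 0<b) = inj₁ (+-nonneg-pos 0≤a 0<b)
  +-nonneg {a} 0≤a (inj₂ refl) = subst (0ℝ ≤_) (sym (+-identityʳ a)) 0≤a

  *-nonneg : ∀ {a b} → 0ℝ ≤ a → 0ℝ ≤ b → 0ℝ ≤ (a * b)
  *-nonneg (inj₁ 0<a) (inj₁ 0<b) = inj₁ (*-pos 0<a 0<b)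
  *-nonneg {a} (inj₁ _) (inj₂ refl) = inj₂ (sym (zeroʳ a))
  *-nonneg {b = b} (inj₂ refl) _ = inj₂ (sym (zeroˡ b))

  square-of-negation : ∀ {x t} → x + t ≡ 0ℝ → t * t ≡ x * x
  square-of-negation {x} {t} x+t≡0 rewrite inverseʳ-unique x t x+t≡0 =
    solve 1 (λ x → (:- x) :* (:- x) := x :* x) refl x

  square-pos : ∀ {x} → x ≢ 0ℝ → 0ℝ < (x * x)
  square-pos {x} x≢0 with compare 0ℝ x
  ... | tri< 0<x _ _ = *-pos 0<x 0<x
  ... | tri≈ _ 0≡x _ = ⊥-elim (x≢0 (sym 0≡x))
  ... | tri> _ _ x<0 with t , 0<t , x+t≡0 ← <⇒gap x<0 =
    subst (0ℝ <_) (square-of-negation x+t≡0) (*-pos 0<t 0<t)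

  square-nonneg : ∀ x → 0ℝ ≤ (x * x)
  square-nonneg x with x ≟ℝ 0ℝ
  ... | yes refl = inj₂ (sym (zeroˡ 0ℝ))
  ... | no x≢0 = inj₁ (square-pos x≢0)

  square≤0⇒zero : ∀ {x} → (x * x) ≤ 0ℝ → x ≡ 0ℝ
  square≤0⇒zero {x} x²≤0 =
    decidable-stable (x ≟ℝ 0ℝ) (λ x≢0 → <-irrefl (<-≤-trans (square-pos x≢0) x²≤0))

  0<1 : 0ℝ < 1ℝ
  0<1 = subst (0ℝ <_) (*-identityˡ 1ℝ) (square-pos (λ 1≡0 → 0≢1 (sym 1≡0)))

  #-suc : ∀ k → # suc k ≡ 1ℝ + # k
  #-suc k = +-assoc 1ℝ _ _

  0<#suc : ∀ k → 0ℝ < (# suc k)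
  0≤# : ∀ k → 0ℝ ≤ (# k)

  0≤# zero = inj₂ (sym (-‿inverseʳ 0ℝ))
  0≤# (suc k) = inj₁ (0<#suc k)

  0<#suc k =
    subst (0ℝ <_) (sym (trans (#-suc k) (+-comm 1ℝ (# k)))) (+-nonneg-pos (0≤# k) 0<1)

  *-cancelˡ : ∀ c {a b} → c ≢ 0ℝ → c * a ≡ c * b → a ≡ b
  *-cancelˡ c {a} {b} c≢0 ca≡cb with d , cd≡1 ← inverse c c≢0 = begin
    a            ≡⟨ sym (*-identityˡ a) ⟩
    1ℝ * a       ≡⟨ cong (_* a) (sym cd≡1) ⟩
    c * d * a    ≡⟨ reassociate a ⟩
    d * (c * a)  ≡⟨ cong (d *_) ca≡cb ⟩
    d * (c * b)  ≡⟨ sym (reassociate b) ⟩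
    c * d * b    ≡⟨ cong (_* b) cd≡1 ⟩
    1ℝ * b       ≡⟨ *-identityˡ b ⟩
    b            ∎
    where
    reassociate : ∀ x → c * d * x ≡ d * (c * x)
    reassociate = solve 3 (λ c d x → c :* d :* x := d :* (c :* x)) refl c d

  square<1 : ∀ {l} → (- 1ℝ) < l → l < 1ℝ → ∃[ e ] 0ℝ < e × l * l + e ≡ 1ℝ
  square<1 {l} -1<l l<1
    with a , 0<a , l+a≡1 ← <⇒gap l<1 | b , 0<b , -1+b≡l ← <⇒gap -1<l =
    a * b , *-pos 0<a 0<b , (begin
      l * l + a * b
        ≡⟨ solve 4 (λ l a b one → l :* l :+ a :* b
                     := (l :+ a) :* (l :+ a) :+ a :* ((:- one :+ b) :- l) :- a :* ((l :+ a) :- one))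
                 refl l a b 1ℝ ⟩
      (l + a) * (l + a) + a * ((- 1ℝ + b) - l) - a * ((l + a) - 1ℝ)
        ≡⟨ cong₂ (λ u v → u * u + a * (v - l) - a * (u - 1ℝ)) l+a≡1 -1+b≡l ⟩
      1ℝ * 1ℝ + a * (l - l) - a * (1ℝ - 1ℝ)
        ≡⟨ solve 3 (λ l a one → one :* one :+ a :* (l :- l) :- a :* (one :- one) := one :* one)
                 refl l a 1ℝ ⟩
      1ℝ * 1ℝ
        ≡⟨ *-identityˡ 1ℝ ⟩
      1ℝ ∎)

  argmax : ∀ {n} (f : Fin (suc n) → ℝ) → ∃[ i ] ∀ j → f j ≤ f i
  argmax {zero} f = zero , λ { zero → inj₂ refl }
  argmax {suc n} f with i , f≤fi ← argmax (f ∘ suc) with compare (f (suc i)) (f zero)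
  ... | tri< fi<f0 _ _ = zero , λ { zero → inj₂ refl ; (suc j) → inj₁ (≤-<-trans (f≤fi j) fi<f0) }
  ... | tri≈ _ fi≡f0 _ = suc i , λ { zero → inj₂ (sym fi≡f0) ; (suc j) → f≤fi j }
  ... | tri> _ _ f0<fi = suc i , λ { zero → inj₁ f0<fi ; (suc j) → f≤fi j }

module EigenEquations (R : Reals) where
  open Reals R using (ℝ; 0ℝ; 1ℝ; _<_; _≤_; *-pos)
  open RealProperties R
  open ≡-Reasoning

  -- ((4 + e) Y)² = 4 (a + b)² ≤ 8 (a² + b²) ≤ 16 Y² is impossible for e > 0, Y ≠ 0.
  dominant-equation-impossible : ∀ {e Y a b} → 0ℝ < e → Y ≢ 0ℝ →
                                 (a * a) ≤ (Y * Y) → (b * b) ≤ (Y * Y) →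
                                 (# 4 + e) * Y + # 2 * (a + b) ≢ 0ℝ
  dominant-equation-impossible {e} {Y} {a} {b} 0<e Y≢0 a²≤Y² b²≤Y² eq
    with ≤⇒gap a²≤Y² | ≤⇒gap b²≤Y²
  ... | α , 0≤α , a²+α≡Y² | β , 0≤β , b²+β≡Y² = <-irrefl (subst (0ℝ <_) slack≡0 0<slack)
    where
    s slack : ℝ
    s = # 2 * (a + b)
    slack = # 4 * ((a - b) * (a - b)) + # 8 * α + # 8 * β + (# 8 * e + e * e) * (Y * Y)

    0<slack : 0ℝ < slack
    0<slack =
      +-nonneg-pos
        (+-nonneg (+-nonneg (*-nonneg (0≤# 4) (square-nonneg (a - b))) (*-nonneg (0≤# 8) 0≤α))
                  (*-nonneg (0≤# 8) 0≤β))
        (*-pos (+-pos (*-pos (0<#suc 7) 0<e) (*-pos 0<e 0<e)) (square-pos Y≢0))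

    slack≡0 : slack ≡ 0ℝ
    slack≡0 = sym (+-cancelˡ (s * s) 0ℝ slack (begin
      s * s + 0ℝ
        ≡⟨ +-identityʳ (s * s) ⟩
      s * s
        ≡⟨ square-of-negation eq ⟩
      (# 4 + e) * Y * ((# 4 + e) * Y)
        ≡⟨ solve 2 (λ e Y → (κ 4 :+ e) :* Y :* ((κ 4 :+ e) :* Y)
                     := κ 8 :* (Y :* Y) :+ κ 8 :* (Y :* Y) :+ (κ 8 :* e :+ e :* e) :* (Y :* Y))
                 refl e Y ⟩
      # 8 * (Y * Y) + # 8 * (Y * Y) + (# 8 * e + e * e) * (Y * Y)
        ≡⟨ cong₂ (λ u v → # 8 * u + # 8 * v + (# 8 * e + e * e) * (Y * Y))
                 (sym a²+α≡Y²) (sym b²+β≡Y²) ⟩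
      # 8 * (a * a + α) + # 8 * (b * b + β) + (# 8 * e + e * e) * (Y * Y)
        ≡⟨ solve 6 (λ a b α β e Y →
                     κ 8 :* (a :* a :+ α) :+ κ 8 :* (b :* b :+ β) :+ (κ 8 :* e :+ e :* e) :* (Y :* Y)
                     := κ 2 :* (a :+ b) :* (κ 2 :* (a :+ b))
                        :+ (κ 4 :* ((a :- b) :* (a :- b)) :+ κ 8 :* α :+ κ 8 :* β
                            :+ (κ 8 :* e :+ e :* e) :* (Y :* Y)))
                 refl a b α β e Y ⟩
      s * s + slack ∎))

  dominated⇒zero : ∀ {n e} (y : Fin (suc n) → ℝ) (f g : Fin (suc n) → Fin (suc n)) → 0ℝ < e →
                   (∀ i → (# 4 + e) * y i + # 2 * (y (f i) + y (g i)) ≡ 0ℝ) → ∀ i → y i ≡ 0ℝ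
  dominated⇒zero y f g 0<e eq j with argmax (λ i → y i * y i)
  ... | i , maximal =
    square≤0⇒zero (subst ((y j * y j) ≤_) (trans (cong₂ _*_ yi≡0 yi≡0) (zeroˡ 0ℝ)) (maximal j))
    where
    yi≡0 : y i ≡ 0ℝ
    yi≡0 = decidable-stable (y i ≟ℝ 0ℝ) λ yi≢0 →
      dominant-equation-impossible 0<e yi≢0 (maximal (f i)) (maximal (g i)) (eq i)

  module _ {l e : ℝ} (l²+e≡1 : l * l + e ≡ 1ℝ) where

    expand : ∀ x → x ≡ l * (l * x) + e * x
    expand x = begin
      x                    ≡⟨ sym (*-identityˡ x) ⟩
      1ℝ * x               ≡⟨ cong (_* x) (sym l²+e≡1) ⟩
      (l * l + e) * x      ≡⟨ solve 3 (λ l e x → (l :* l :+ e) :* x := l :* (l :* x) :+ e :* x)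
                                      refl l e x ⟩
      l * (l * x) + e * x  ∎

    return-trip : ∀ {x X P Y} → l * x ≡ X + P → l * P ≡ Y + x → l * X + Y + e * x ≡ 0ℝ
    return-trip {x} {X} {P} {Y} lx≡X+P lP≡Y+x = +-cancelʳ x _ _ (begin
      l * X + Y + e * x + x      ≡⟨ solve 5 (λ l e x X Y → l :* X :+ Y :+ e :* x :+ x
                                                        := l :* X :+ (Y :+ x) :+ e :* x) refl l e x X Y ⟩
      l * X + (Y + x) + e * x    ≡⟨ cong (λ z → l * X + z + e * x) (sym lP≡Y+x) ⟩
      l * X + l * P + e * x      ≡⟨ solve 5 (λ l e x X P → l :* X :+ l :* P :+ e :* x
                                                        := l :* (X :+ P) :+ e :* x) refl l e x X P ⟩
      l * (X + P) + e * x        ≡⟨ cong (λ z → l * z + e * x) (sym lx≡X+P) ⟩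
      l * (l * x) + e * x        ≡⟨ sym (expand x) ⟩
      x                          ≡⟨ sym (+-identityˡ x) ⟩
      0ℝ + x                     ∎)

    twins-equal : ∀ {x x′ X P P′ Y} → e ≢ 0ℝ →
                  l * x ≡ X + P → l * x′ ≡ X + P′ → l * P ≡ Y + x → l * P′ ≡ Y + x′ → x ≡ x′
    twins-equal {X = X} {Y = Y} e≢0 lx lx′ lP lP′ =
      *-cancelˡ e e≢0 (+-cancelˡ (l * X + Y) _ _ (trans (return-trip lx lP) (sym (return-trip lx′ lP′))))

    path-recurrence : ∀ {y Z W a b} → l * y ≡ Z + Z + W → l * Z ≡ y + y + a → l * W ≡ b + b + y →
                      (# 4 + e) * y + # 2 * (a + b) ≡ 0ℝ
    path-recurrence {y} {Z} {W} {a} {b} ly lZ lW = +-cancelʳ y _ _ (begin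
      (# 4 + e) * y + # 2 * (a + b) + y
        ≡⟨ solve 4 (λ e y a b → (κ 4 :+ e) :* y :+ κ 2 :* (a :+ b) :+ y
                     := (y :+ y :+ a) :+ (y :+ y :+ a) :+ (b :+ b :+ y) :+ e :* y) refl e y a b ⟩
      (y + y + a) + (y + y + a) + (b + b + y) + e * y
        ≡⟨ cong₂ (λ u v → u + u + v + e * y) (sym lZ) (sym lW) ⟩
      l * Z + l * Z + l * W + e * y
        ≡⟨ solve 5 (λ l e y Z W → l :* Z :+ l :* Z :+ l :* W :+ e :* y
                     := l :* (Z :+ Z :+ W) :+ e :* y) refl l e y Z W ⟩
      l * (Z + Z + W) + e * y
        ≡⟨ cong (λ z → l * z + e * y) (sym ly) ⟩
      l * (l * y) + e * y
        ≡⟨ sym (expand y) ⟩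
      y
        ≡⟨ sym (+-identityˡ y) ⟩
      0ℝ + y ∎)

module ℕ-Sums = IndicatorSums ℕ.+-0-commutativeMonoid

length-filterᵇ-tabulate : ∀ {n} {A : Set} (p : A → Bool) (f : Fin n → A) →
                          length (filterᵇ p (tabulate f)) ≡ ℕ-Sums.sum (λ i → if p (f i) then 1 else 0)
length-filterᵇ-tabulate {zero} p f = refl
length-filterᵇ-tabulate {suc n} p f with p (f zero)
... | true  = cong suc (length-filterᵇ-tabulate p (f ∘ suc))
... | false = length-filterᵇ-tabulate p (f ∘ suc)

≟-disjoint : ∀ {n} {p q : Fin n} → p ≢ q → ∀ w → does (w ≟ p) ∧ does (w ≟ q) ≡ false
≟-disjoint {p = p} {q} p≢q w with w ≟ p | w ≟ q
... | yes refl | yes refl = ⊥-elim (p≢q refl)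
... | yes _    | no _     = refl
... | no _     | _        = refl

rooted⇒connected : ∀ {n} (G : Graph n) (r : Fin n) → (∀ v → Star (Adjacent G) r v) → Connected G
rooted⇒connected G r reach u v =
  reverse (λ {u} {v} u~v → trans (Graph.sym G v u) u~v) (reach u) ◅◅ reach v

module NeighbourGraph {N : ℕ} (nb : Fin 3 → Fin N → Fin N)
                      (nb-return : ∀ e v → ∃[ e′ ] nb e′ (nb e v) ≡ v)
                      (nb-injective : ∀ v → Injective _≡_ _≡_ (λ e → nb e v))
                      (nb-loopless : ∀ e v → nb e v ≢ v) where

  isNeighbour : Fin N → Fin N → Bool
  isNeighbour v w = (does (w ≟ nb 0F v) ∨ does (w ≟ nb 1F v)) ∨ does (w ≟ nb 2F v)

  isNeighbour⇒nb : ∀ {v w} → isNeighbour v w ≡ true → ∃[ e ] w ≡ nb e v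
  isNeighbour⇒nb {v} {w} v~w with w ≟ nb 0F v | w ≟ nb 1F v | w ≟ nb 2F v
  ... | yes w≡ | _      | _      = 0F , w≡
  ... | no _   | yes w≡ | _      = 1F , w≡
  ... | no _   | no _   | yes w≡ = 2F , w≡
  isNeighbour⇒nb () | no _ | no _ | no _

  nb-isNeighbour : ∀ e v → isNeighbour v (nb e v) ≡ true
  nb-isNeighbour 0F v rewrite dec-true (nb 0F v ≟ nb 0F v) refl = refl
  nb-isNeighbour 1F v
    rewrite dec-true (nb 1F v ≟ nb 1F v) refl | ∨-zeroʳ (does (nb 1F v ≟ nb 0F v)) = refl
  nb-isNeighbour 2F v rewrite dec-true (nb 2F v ≟ nb 2F v) refl = ∨-zeroʳ _

  isNeighbour-sym : ∀ {v w} → isNeighbour v w ≡ true → isNeighbour w v ≡ true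
  isNeighbour-sym {v} {w} v~w
    with e , refl ← isNeighbour⇒nb {v} {w} v~w with e′ , back ← nb-return e v =
    subst (λ u → isNeighbour (nb e v) u ≡ true) back (nb-isNeighbour e′ (nb e v))

  graph : Graph N
  graph = record
    { adj    = isNeighbour
    ; sym    = λ u v → ⇔→≡ (mk⇔ (isNeighbour-sym {u} {v}) (isNeighbour-sym {v} {u}))
    ; irrefl = λ v → ¬-not λ v~v → let e , v≡ = isNeighbour⇒nb v~v in nb-loopless e v (sym v≡)
    }

  nb-distinct : ∀ v {e e′} → e ≢ e′ → nb e v ≢ nb e′ v
  nb-distinct v e≢e′ = e≢e′ ∘ nb-injective v

  module _ {a ℓ} (M : CommutativeMonoid a ℓ) where
    open CommutativeMonoid M using (Carrier; _≈_; _∙_; ε; ∙-cong; ∙-congʳ; setoid)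
    open IndicatorSums M
    open import Relation.Binary.Reasoning.Setoid setoid

    ∑-neighbours : ∀ v (x : Fin N → Carrier) →
                   sum (λ w → if isNeighbour v w then x w else ε)
                   ≈ x (nb 0F v) ∙ x (nb 1F v) ∙ x (nb 2F v)
    ∑-neighbours v x = begin
      sum (λ w → if (δ 0F w ∨ δ 1F w) ∨ δ 2F w then x w else ε)
        ≈⟨ ∑-∨ (λ w → δ 0F w ∨ δ 1F w) (δ 2F) x δ₀₁-δ₂-disjoint ⟩
      sum (λ w → if δ 0F w ∨ δ 1F w then x w else ε) ∙ part 2F
        ≈⟨ ∙-congʳ (∑-∨ (δ 0F) (δ 1F) x (δ-disjoint λ ())) ⟩
      part 0F ∙ part 1F ∙ part 2F
        ≈⟨ ∙-cong (∙-cong (∑-indicator (nb 0F v) x) (∑-indicator (nb 1F v) x))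
                  (∑-indicator (nb 2F v) x) ⟩
      x (nb 0F v) ∙ x (nb 1F v) ∙ x (nb 2F v) ∎
      where
      δ : Fin 3 → Fin N → Bool
      δ e w = does (w ≟ nb e v)

      part : Fin 3 → Carrier
      part e = sum (λ w → if δ e w then x w else ε)

      δ-disjoint : ∀ {e e′} → e ≢ e′ → ∀ w → δ e w ∧ δ e′ w ≡ false
      δ-disjoint e≢e′ = ≟-disjoint (nb-distinct v e≢e′)

      δ₀₁-δ₂-disjoint : ∀ w → (δ 0F w ∨ δ 1F w) ∧ δ 2F w ≡ false
      δ₀₁-δ₂-disjoint w = trans (∧-distribʳ-∨ (δ 2F w) (δ 0F w) (δ 1F w))
                                (cong₂ _∨_ (δ-disjoint (λ ()) w) (δ-disjoint (λ ()) w))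

  cubic : Cubic graph
  cubic v = trans (length-filterᵇ-tabulate (isNeighbour v) (λ w → w))
                  (∑-neighbours ℕ.+-0-commutativeMonoid v (λ _ → 1))

  module _ (R : Reals) where
    open Reals R using (ℝ; 0ℝ; 1ℝ)
    open RealProperties R
    open ≡-Reasoning

    adjacency-sum : ∀ v (x : Fin N → ℝ) →
                    sumℝ R (λ w → adjMatrix R graph v w * x w)
                    ≡ x (nb 0F v) + x (nb 1F v) + x (nb 2F v)
    adjacency-sum v x = begin
      sumℝ R (λ w → adjMatrix R graph v w * x w)
        ≡⟨ sumℝ≡sum (λ w → adjMatrix R graph v w * x w) ⟩
      sum (λ w → adjMatrix R graph v w * x w)
        ≡⟨ sum-cong-≗ (λ w → if-* (isNeighbour v w) (x w)) ⟩
      sum (λ w → if isNeighbour v w then x w else 0ℝ)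
        ≡⟨ ∑-neighbours +-commutativeMonoid v x ⟩
      x (nb 0F v) + x (nb 1F v) + x (nb 2F v) ∎
      where
      if-* : ∀ b z → (if b then 1ℝ else 0ℝ) * z ≡ (if b then z else 0ℝ)
      if-* true  z = *-identityˡ z
      if-* false z = zeroˡ z

-- next (suc i) is suc (next i), except when next i wraps around to zero.
sucExceptZero : ∀ {n} → Fin (suc n) → Fin (suc (suc n))
sucExceptZero zero    = zero
sucExceptZero (suc j) = suc (suc j)

next : ∀ {n} → Fin (suc n) → Fin (suc n)
next {zero}  zero    = zero
next {suc n} zero    = suc zero
next {suc n} (suc i) = sucExceptZero (next i)

prev : ∀ {n} → Fin (suc n) → Fin (suc n)
prev {n} zero = fromℕ n
prev (suc i)  = inject₁ i

next-fromℕ : ∀ n → next (fromℕ n) ≡ zero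
next-fromℕ zero = refl
next-fromℕ (suc n) rewrite next-fromℕ n = refl

next-inject₁ : ∀ {n} (i : Fin n) → next (inject₁ i) ≡ suc i
next-inject₁ {suc n} zero = refl
next-inject₁ {suc n} (suc i) rewrite next-inject₁ i = refl

next-prev : ∀ {n} (i : Fin (suc n)) → next (prev i) ≡ i
next-prev {n} zero = next-fromℕ n
next-prev (suc i)  = next-inject₁ i

prev-next : ∀ {n} (i : Fin (suc n)) → prev (next i) ≡ i
prev-next {zero}  zero    = refl
prev-next {suc n} zero    = refl
prev-next {suc n} (suc i) = begin
  prev (sucExceptZero (next i)) ≡⟨ prev-sucExceptZero (next i) ⟩
  suc (prev (next i))           ≡⟨ cong suc (prev-next i) ⟩
  suc i                         ∎
  where
  open ≡-Reasoning
  prev-sucExceptZero : ∀ {n} (j : Fin (suc n)) → prev (sucExceptZero j) ≡ suc (prev j)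
  prev-sucExceptZero zero    = refl
  prev-sucExceptZero (suc j) = refl

next-fixpointFree : ∀ {n} (i : Fin (suc (suc n))) → next i ≢ i
next-fixpointFree zero ()
next-fixpointFree {zero} (suc zero) ()
next-fixpointFree {suc n} (suc i) next≡ with next i in eq
... | suc j = next-fixpointFree i (trans eq (suc-injective next≡))

prev-fixpointFree : ∀ {n} (i : Fin (suc (suc n))) → prev i ≢ i
prev-fixpointFree i prev≡ = next-fixpointFree i (trans (cong next (sym prev≡)) (next-prev i))

module Necklace (k : ℕ) where
  m : ℕ
  m = suc (suc k)

  -- A vertex is (bead, colour, side), colour 0F being white.
  Vertex : Set
  Vertex = Fin m × Fin 2 × Fin 2

  colour : Vertex → Fin 2
  colour (_ , c , _) = c

  flip : Fin 2 → Fin 2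
  flip 0F = 1F
  flip 1F = 0F

  white : Fin 2 → Bool
  white 0F = true
  white 1F = false

  white-flip : ∀ c → white (flip c) ≢ white c
  white-flip 0F ()
  white-flip 1F ()

  step : Fin 2 → Fin m → Fin m
  step 0F = prev
  step 1F = next

  step-fixpointFree : ∀ c i → step c i ≢ i
  step-fixpointFree 0F = prev-fixpointFree
  step-fixpointFree 1F = next-fixpointFree

  neighbour : Fin 3 → Vertex → Vertex
  neighbour 0F (i , c , s) = i , flip c , 0F
  neighbour 1F (i , c , s) = i , flip c , 1F
  neighbour 2F (i , c , s) = step c i , flip c , s

  neighbour-return : ∀ e v → ∃[ e′ ] neighbour e′ (neighbour e v) ≡ v
  neighbour-return 0F (i , 0F , 0F) = 0F , refl
  neighbour-return 0F (i , 0F , 1F) = 1F , refl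
  neighbour-return 0F (i , 1F , 0F) = 0F , refl
  neighbour-return 0F (i , 1F , 1F) = 1F , refl
  neighbour-return 1F (i , 0F , 0F) = 0F , refl
  neighbour-return 1F (i , 0F , 1F) = 1F , refl
  neighbour-return 1F (i , 1F , 0F) = 0F , refl
  neighbour-return 1F (i , 1F , 1F) = 1F , refl
  neighbour-return 2F (i , 0F , s)  = 2F , cong (_, 0F , s) (next-prev i)
  neighbour-return 2F (i , 1F , s)  = 2F , cong (_, 1F , s) (prev-next i)

  neighbour-injective : ∀ v → Injective _≡_ _≡_ (λ e → neighbour e v)
  neighbour-injective v         {0F} {0F} _ = refl
  neighbour-injective v         {1F} {1F} _ = refl
  neighbour-injective v         {2F} {2F} _ = refl
  neighbour-injective v         {0F} {1F} ()
  neighbour-injective v         {1F} {0F} ()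
  neighbour-injective (i , c , s) {0F} {2F} eq = ⊥-elim (step-fixpointFree c i (sym (cong proj₁ eq)))
  neighbour-injective (i , c , s) {1F} {2F} eq = ⊥-elim (step-fixpointFree c i (sym (cong proj₁ eq)))
  neighbour-injective (i , c , s) {2F} {0F} eq = ⊥-elim (step-fixpointFree c i (cong proj₁ eq))
  neighbour-injective (i , c , s) {2F} {1F} eq = ⊥-elim (step-fixpointFree c i (cong proj₁ eq))

  neighbour-flips : ∀ e v → white (colour (neighbour e v)) ≢ white (colour v)
  neighbour-flips 0F (_ , c , _) = white-flip c
  neighbour-flips 1F (_ , c , _) = white-flip c
  neighbour-flips 2F (_ , c , _) = white-flip c

  N : ℕ
  N = m ℕ.* 4

  encode : Vertex → Fin N
  encode (i , c , s) = combine i (combine c s)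

  decode : Fin N → Vertex
  decode v = map₂ (remQuot 2) (remQuot 4 v)

  decode-encode : ∀ w → decode (encode w) ≡ w
  decode-encode (i , c , s) =
    trans (cong (map₂ (remQuot 2)) (remQuot-combine i (combine c s))) (cong (i ,_) (remQuot-combine c s))

  encode-decode : ∀ v → encode (decode v) ≡ v
  encode-decode v =
    trans (cong (combine (proj₁ (remQuot {m} 4 v))) (combine-remQuot {2} 2 (proj₂ (remQuot {m} 4 v))))
          (combine-remQuot {m} 4 v)

  encode-injective : Injective _≡_ _≡_ encode
  encode-injective {w} {w′} eq = trans (sym (decode-encode w)) (trans (cong decode eq) (decode-encode w′))

  nb : Fin 3 → Fin N → Fin N
  nb e v = encode (neighbour e (decode v))

  nb-decode : ∀ e v → decode (nb e v) ≡ neighbour e (decode v)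
  nb-decode e v = decode-encode (neighbour e (decode v))

  nb-return : ∀ e v → ∃[ e′ ] nb e′ (nb e v) ≡ v
  nb-return e v with e′ , back ← neighbour-return e (decode v) =
    e′ , trans (cong (encode ∘ neighbour e′) (nb-decode e v)) (trans (cong encode back) (encode-decode v))

  nb-injective : ∀ v → Injective _≡_ _≡_ (λ e → nb e v)
  nb-injective v = neighbour-injective (decode v) ∘ encode-injective

  nb-loopless : ∀ e v → nb e v ≢ v
  nb-loopless e v nb≡v =
    neighbour-flips e (decode v) (cong (white ∘ colour) (trans (sym (nb-decode e v)) (cong decode nb≡v)))

  open NeighbourGraph nb nb-return nb-injective nb-loopless public

  bipartite : Bipartite graph
  bipartite = white ∘ colour ∘ decode , properly-coloured
    where
    properly-coloured : ∀ u v → Adjacent graph u v → white (colour (decode u)) ≢ white (colour (decode v))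
    properly-coloured u v u~v with e , refl ← isNeighbour⇒nb {u} {v} u~v = λ same →
      neighbour-flips e (decode u) (trans (cong (white ∘ colour) (sym (nb-decode e u))) (sym same))

  Walk : Vertex → Vertex → Set
  Walk v w = Star (Adjacent graph) (encode v) (encode w)

  edge : ∀ e v → Walk v (neighbour e v)
  edge e v = subst (Adjacent graph (encode v)) (cong (encode ∘ neighbour e) (decode-encode v))
                   (nb-isNeighbour e (encode v)) ◅ []

  bead-reachable : ∀ i → Walk (0F , 0F , 0F) (i , 0F , 0F)
  bead-reachable = <-weakInduction (λ i → Walk (0F , 0F , 0F) (i , 0F , 0F)) [] λ i walk →
    walk ◅◅ edge 0F (inject₁ i , 0F , 0F)
         ◅◅ subst (λ j → Walk (inject₁ i , 1F , 0F) (j , 0F , 0F)) (next-inject₁ i)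
                  (edge 2F (inject₁ i , 1F , 0F))

  reachable : ∀ v → Walk (0F , 0F , 0F) v
  reachable (i , 0F , 0F) = bead-reachable i
  reachable (i , 1F , 0F) = bead-reachable i ◅◅ edge 0F (i , 0F , 0F)
  reachable (i , 1F , 1F) = bead-reachable i ◅◅ edge 1F (i , 0F , 0F)
  reachable (i , 0F , 1F) = bead-reachable i ◅◅ edge 0F (i , 0F , 0F) ◅◅ edge 1F (i , 1F , 0F)

  connected : Connected graph
  connected = rooted⇒connected graph (encode (0F , 0F , 0F))
                λ v → subst (Star (Adjacent graph) _) (encode-decode v) (reachable (decode v))

  module _ (R : Reals) where
    open Reals R using (ℝ; 0ℝ; 1ℝ; _<_)
    open RealProperties R
    open EigenEquations R

    module _ {l e} (0<e : 0ℝ < e) (l²+e≡1 : l * l + e ≡ 1ℝ) (x : Vertex → ℝ)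
             (eigen : ∀ v → x (neighbour 0F v) + x (neighbour 1F v) + x (neighbour 2F v) ≡ l * x v)
             where

      eigen-across : ∀ c i s →
        l * x (step c i , flip c , s) ≡ x (step c i , c , 0F) + x (step c i , c , 1F) + x (i , c , s)
      eigen-across 0F i s = trans (sym (eigen _))
        (cong (λ j → x (prev i , 0F , 0F) + x (prev i , 0F , 1F) + x (j , 0F , s)) (next-prev i))
      eigen-across 1F i s = trans (sym (eigen _))
        (cong (λ j → x (next i , 1F , 0F) + x (next i , 1F , 1F) + x (j , 1F , s)) (prev-next i))

      sides-agree : ∀ i c → x (i , c , 0F) ≡ x (i , c , 1F)
      sides-agree i c = twins-equal l²+e≡1 (λ e≡0 → <-irrefl (subst (0ℝ <_) e≡0 0<e))
        (sym (eigen _)) (sym (eigen _)) (eigen-across c i 0F) (eigen-across c i 1F)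

      y : Fin m → Fin 2 → ℝ
      y i c = x (i , c , 0F)

      y-eigen : ∀ c i → l * y i c ≡ y i (flip c) + y i (flip c) + y (step c i) (flip c)
      y-eigen c i =
        trans (sym (eigen _))
              (cong (λ z → y i (flip c) + z + y (step c i) (flip c)) (sym (sides-agree i (flip c))))

      recurrence : ∀ c i → (# 4 + e) * y i c + # 2 * (y (step (flip c) i) c + y (step c i) c) ≡ 0ℝ
      recurrence 0F i = path-recurrence l²+e≡1 (y-eigen 0F i) (y-eigen 1F i)
        (trans (y-eigen 1F (prev i)) (cong (λ j → y (prev i) 0F + y (prev i) 0F + y j 0F) (next-prev i)))
      recurrence 1F i = path-recurrence l²+e≡1 (y-eigen 1F i) (y-eigen 0F i)
        (trans (y-eigen 0F (next i)) (cong (λ j → y (next i) 1F + y (next i) 1F + y j 1F) (prev-next i)))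

      eigenvector-zero : ∀ v → x v ≡ 0ℝ
      eigenvector-zero (i , c , 0F) =
        dominated⇒zero (λ j → y j c) (step (flip c)) (step c) 0<e (recurrence c) i
      eigenvector-zero (i , c , 1F) = trans (sym (sides-agree i c)) (eigenvector-zero (i , c , 0F))

    noEigenvalueIn-1,1 : NoEigenvalueIn-1,1 R graph
    noEigenvalueIn-1,1 l -1<l l<1 (x , (v , xv≢0) , eigen)
      with e , 0<e , l²+e≡1 ← square<1 -1<l l<1 =
      xv≢0 (trans (cong x (sym (encode-decode v)))
                  (eigenvector-zero 0<e l²+e≡1 (x ∘ encode) eigen′ (decode v)))
      where
      neighbour-sum : Vertex → ℝ
      neighbour-sum u = x (encode (neighbour 0F u)) + x (encode (neighbour 1F u)) + x (encode (neighbour 2F u))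

      eigen′ : ∀ w → neighbour-sum w ≡ l * x (encode w)
      eigen′ w = subst (λ u → neighbour-sum u ≡ l * x (encode w)) (decode-encode w)
                       (trans (sym (adjacency-sum R (encode w) x)) (eigen (encode w)))

necklace : ℕ → Σ ℕ Graph
necklace k = Necklace.N k , Necklace.graph k

Fin-↔⇒≡ : ∀ {n n′} → Fin n ↔ Fin n′ → n ≡ n′
Fin-↔⇒≡ f =
  cantor-schröder-bernstein (Injection.injective (↔⇒↣ f)) (Injection.injective (↔⇒↣ (↔-sym f)))

theorem3 : (R : Reals) →
    Σ (ℕ → Σ ℕ Graph) λ G →
    (∀ k → Connected (proj₂ (G k)) × Cubic (proj₂ (G k))
    × Bipartite (proj₂ (G k)) × NoEigenvalueIn-1,1 R (proj₂ (G k)))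
    × (∀ i j → i ≢ j → ¬ Isomorphic (proj₂ (G i)) (proj₂ (G j)))
theorem3 R =
  necklace , (λ k → connected k , cubic k , bipartite k , noEigenvalueIn-1,1 k R) , non-isomorphic
  where
  open Necklace using (connected; cubic; bipartite; noEigenvalueIn-1,1)
  non-isomorphic : ∀ i j → i ≢ j → ¬ Isomorphic (proj₂ (necklace i)) (proj₂ (necklace j))
  non-isomorphic i j i≢j (f , _) =
    i≢j (ℕ.suc-injective (ℕ.suc-injective (ℕ.*-cancelʳ-≡ _ _ 4 (Fin-↔⇒≡ f))))
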